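{- The set $I_{XTD^+} = \{e : \mathrm{XTD}^+(\mathcal L_e) < \infty\}$ is $\Pi^0_2$-complete.
   Context: $W_0,W_1,\ldots$ is an acceptable numbering of all r.e. subsets of $\mathbb N$; $L^e_j = \{x : \langle j,x\rangle \in W_e\}$ and $\mathcal L_e = \{L^e_j : j\in\mathbb N\}$. For a family $\mathcal L$ of subsets of $\mathbb N$ and a set $L\subseteq\mathbb N$, a set $S\subseteq L$ is a positive specifying set for $L$ w.r.t. $\mathcal L$ iff at most one member of $\mathcal L$ contains $S$. $\mathrm{XTD}^+(\mathcal L) = \inf\{d : \text{every nonempty } L\subseteq\mathbb N \text{ has a positive specifying set w.r.t. } \mathcal L \text{ with at most } d \text{ elements}\}$; if some nonempty $L$ has no positive specifying set, $\mathrm{XTD}^+(\mathcal L)=\infty$. $\Pi^0_n$-complete means definable by a $\Pi^0_n$ formula and every $\Pi^0_n$ set many-one reduces to it via a recursive function. -}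

module Defs where

open import Level using (0ℓ)
open import Data.Nat using (ℕ; zero; suc; _+_; _*_; _≤_; _/_; _%_)
open import Data.Product using (Σ; ∃; _×_; _,_; proj₁; proj₂)
open import Data.Maybe using (Maybe; just; nothing; _>>=_)
open import Data.List using (List; length)
open import Data.List.Relation.Unary.All using (All)
open import Relation.Binary.PropositionalEquality using (_≡_)
open import Relation.Unary using (Pred)
open import Function.Bundles using (_⇔_)

-- Cantor pairing  ⟨x,y⟩ = (x+y)(x+y+1)/2 + y  and its inverse.

tri : ℕ → ℕ
tri zero    = zero
tri (suc n) = suc n + tri n

pair : ℕ → ℕ → ℕ
pair x y = tri (x + y) + y

-- enumerate ℕ×ℕ diagonal by diagonal: (0,0),(1,0),(0,1),(2,0),(1,1),(0,2),…
unpair : ℕ → ℕ × ℕ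
unpair zero = 0 , 0
unpair (suc n) with unpair n
... | zero  , y = suc y , 0
... | suc x , y = x , suc y

-- A standard model of computation: codes of unary partial recursive
-- functions (Kleene-style basis using the pairing function).

data Code : Set where
  zer succ idc fstc sndc : Code
  pairc compc precc      : Code → Code → Code
  muc                    : Code → Code

decode′ : ℕ → ℕ → Code
decode′ zero    n = zer
decode′ (suc f) n with n % 9
... | 0 = zer
... | 1 = succ
... | 2 = idc
... | 3 = fstc
... | 4 = sndc
... | 5 = pairc (decode′ f (proj₁ (unpair (n / 9)))) (decode′ f (proj₂ (unpair (n / 9))))
... | 6 = compc (decode′ f (proj₁ (unpair (n / 9)))) (decode′ f (proj₂ (unpair (n / 9))))
... | 7 = precc (decode′ f (proj₁ (unpair (n / 9)))) (decode′ f (proj₂ (unpair (n / 9))))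
... | _ = muc (decode′ f (n / 9))

decode : ℕ → Code
decode n = decode′ n n

-- Step-indexed evaluation: nothing = out of fuel / undefined.
mutual
  eval : ℕ → Code → ℕ → Maybe ℕ
  eval zero    _           _ = nothing
  eval (suc k) zer         x = just 0
  eval (suc k) succ        x = just (suc x)
  eval (suc k) idc         x = just x
  eval (suc k) fstc        x = just (proj₁ (unpair x))
  eval (suc k) sndc        x = just (proj₂ (unpair x))
  eval (suc k) (pairc f g) x =
    eval k f x >>= λ a → eval k g x >>= λ b → just (pair a b)
  eval (suc k) (compc f g) x = eval k g x >>= eval k f
  eval (suc k) (precc f g) x = primrec k f g (proj₁ (unpair x)) (proj₂ (unpair x))
  eval (suc k) (muc f)     x = search k k f x 0

  primrec : ℕ → Code → Code → ℕ → ℕ → Maybe ℕ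
  primrec k f g x zero    = eval k f x
  primrec k f g x (suc n) =
    primrec k f g x n >>= λ h → eval k g (pair x (pair n h))

  search : ℕ → ℕ → Code → ℕ → ℕ → Maybe ℕ
  search k zero    f x y = nothing
  search k (suc b) f x y with eval k f (pair x y)
  ... | nothing      = nothing
  ... | just zero    = just y
  ... | just (suc _) = search k b f x (suc y)

_⟨_⟩↓_ : ℕ → ℕ → ℕ → Set
e ⟨ x ⟩↓ y = ∃ λ k → eval k (decode e) x ≡ just y

W : ℕ → Pred ℕ 0ℓ
W e x = ∃ λ y → e ⟨ x ⟩↓ y

Recursive : (ℕ → ℕ) → Set
Recursive f = ∃ λ c → ∀ x → c ⟨ x ⟩↓ f x

IsΠ⁰₂ : ∀ {ℓ} → (ℕ → Set ℓ) → Set ℓ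
IsΠ⁰₂ P = Σ (ℕ → ℕ) λ g → Recursive g ×
  (∀ e → P e ⇔ (∀ x → ∃ λ y → g (pair e (pair x y)) ≡ 0))

_≤ₘ_ : ∀ {ℓ₁ ℓ₂} → (ℕ → Set ℓ₁) → (ℕ → Set ℓ₂) → Set _
A ≤ₘ B = Σ (ℕ → ℕ) λ f → Recursive f × (∀ x → A x ⇔ B (f x))

IsΠ⁰₂-complete : ∀ {ℓ} → (ℕ → Set ℓ) → Set (Level.suc 0ℓ Level.⊔ ℓ)
IsΠ⁰₂-complete P = IsΠ⁰₂ P × (∀ (A : ℕ → Set) → IsΠ⁰₂ A → A ≤ₘ P)

Lang : ℕ → ℕ → Pred ℕ 0ℓ
Lang e j x = W e (pair j x)

-- Indexed family of sets (members are the sets 𝓛 j, compared extensionally)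
Family : Set₁
Family = ℕ → Pred ℕ 0ℓ

PositiveSpecifyingSet : Family → Pred ℕ 0ℓ → List ℕ → Set
PositiveSpecifyingSet 𝓛 L S =
  All L S ×
  (∀ i j → All (𝓛 i) S → All (𝓛 j) S → ∀ x → 𝓛 i x ⇔ 𝓛 j x)

XTD⁺-finite : Family → Set₁
XTD⁺-finite 𝓛 = ∃ λ (d : ℕ) → ∀ (L : Pred ℕ 0ℓ) → (∃ λ x → L x) →
  Σ (List ℕ) λ S → length S ≤ d × PositiveSpecifyingSet 𝓛 L S

I-XTD⁺ : ℕ → Set₁
I-XTD⁺ e = XTD⁺-finite (Lang e)

-- For any family 𝓛, XTD⁺(𝓛) < ∞ iff 𝓛 is
-- overlap-closed: members sharing an element are equal.  A positive
-- specifying set for {x} is a subset of {x}, so at most one member contains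
-- x; conversely, in an overlap-closed family {x} specifies every L ∋ x, so
-- XTD⁺ ≤ 1.  For 𝓛_e overlap-closure is the Π⁰₂ condition
--   ∀ i j x z. ⟨i,x⟩, ⟨j,x⟩, ⟨i,z⟩ ∈ W_e → ⟨j,z⟩ ∈ W_e.
--
-- To express this condition with a recursive matrix for the
-- concrete model of Defs we prove a Kleene normal form W_e w ⇔ ∃s. T(e,w,s) = 0
-- with T computable, by simulating eval on a stack machine whose step function
-- is assembled from basic computable functions.  For hardness we show that a
-- μ-search program turns every Σ⁰₁ relation into an r.e. set, uniformly.
--
-- For A = {x : ∀n ∃y g⟨x,⟨n,y⟩⟩ = 0} we build f with
-- L₀ = ℕ and L_{n+1} = {0} ∪ {z > 0 : ∃y g⟨x,⟨n,y⟩⟩ = 0} in 𝓛_{f(x)}; every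
-- member contains 0, so 𝓛_{f(x)} is overlap-closed iff all L_{n+1} = ℕ iff x ∈ A.
module Submission where

open import Level using (0ℓ)
open import Defs
open import Data.Nat
open import Data.Nat.Properties
open import Data.Nat.DivMod
open import Data.Nat.Divisibility using (divides)
open import Data.Product using (Σ; ∃; _×_; _,_; proj₁; proj₂)
open import Data.Sum using (_⊎_; inj₁; inj₂)
open import Data.Maybe using (Maybe; just; nothing; _>>=_)
open import Data.Maybe.Properties using (just-injective)
open import Data.Empty using (⊥-elim)
open import Data.List using ([]; _∷_)
open import Data.List.Relation.Unary.All using ([]; _∷_)
import Data.List.Relation.Unary.All as All
open import Relation.Binary.PropositionalEquality
open import Relation.Unary using (Pred)
open import Relation.Nullary.Decidable using (from-yes)
open import Function.Bundles using (_⇔_; mk⇔; Equivalence)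
open import Function.Construct.Composition using (_⇔-∘_)
open import Function.Construct.Identity using (⇔-id)
open import Function.Construct.Symmetry using (⇔-sym)

open Equivalence using (to; from)

-- Overlap-closed families

-- Whenever two members share an element, the first is contained in the
-- second (applied both ways, the two members are equal).
OverlapClosed : Family → Set
OverlapClosed 𝓛 = ∀ i j x z → 𝓛 i x → 𝓛 j x → 𝓛 i z → 𝓛 j z

module _ {𝓛 : Family} where

  singleton-specifies : OverlapClosed 𝓛 → ∀ {L : Pred ℕ 0ℓ} {x} → L x →
                        PositiveSpecifyingSet 𝓛 L (x ∷ [])
  singleton-specifies oc {x = x} Lx = Lx ∷ [] , λ { i j (ix ∷ []) (jx ∷ []) z →
    mk⇔ (oc i j x z ix jx) (oc j i x z jx ix) }

  -- A specifying set for the singleton {x} leaves room for only one member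
  -- containing x, so members meeting at x are equal.
  specifying-singleton⇒overlap : ∀ {x S} → PositiveSpecifyingSet 𝓛 (_≡ x) S →
                                 ∀ i j z → 𝓛 i x → 𝓛 j x → 𝓛 i z → 𝓛 j z
  specifying-singleton⇒overlap (S⊆x , unique) i j z ix jx =
    to (unique i j (All.map (λ { refl → ix }) S⊆x) (All.map (λ { refl → jx }) S⊆x) z)

  XTD⁺-finite⇔overlapClosed : XTD⁺-finite 𝓛 ⇔ OverlapClosed 𝓛
  XTD⁺-finite⇔overlapClosed = mk⇔ finite⇒closed closed⇒finite
    where
    finite⇒closed : XTD⁺-finite 𝓛 → OverlapClosed 𝓛
    finite⇒closed (d , specify) i j x =
      specifying-singleton⇒overlap (proj₂ (proj₂ (specify (_≡ x) (x , refl)))) i j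

    closed⇒finite : OverlapClosed 𝓛 → XTD⁺-finite 𝓛
    closed⇒finite oc = 1 , λ { L (x , Lx) → x ∷ [] , s≤s z≤n , singleton-specifies oc Lx }

-- Pairing

pair-suc-right : ∀ x y → pair x (suc y) ≡ suc (pair (suc x) y)
pair-suc-right x y = begin
    tri (x + suc y) + suc y        ≡⟨ cong (λ v → tri v + suc y) (+-suc x y) ⟩
    tri (suc (x + y)) + suc y      ≡⟨ +-suc (tri (suc (x + y))) y ⟩
    suc (tri (suc (x + y)) + y)    ∎
  where open ≡-Reasoning

pair-next-diagonal : ∀ y → pair (suc y) 0 ≡ suc (pair 0 y)
pair-next-diagonal y = begin
    tri (suc y + 0) + 0   ≡⟨ +-identityʳ _ ⟩
    tri (suc y + 0)       ≡⟨ cong (λ v → tri (suc v)) (+-identityʳ y) ⟩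
    suc (y + tri y)       ≡⟨ cong suc (+-comm y (tri y)) ⟩
    suc (tri y + y)       ∎
  where open ≡-Reasoning

unpair-pair : ∀ x y → unpair (pair x y) ≡ (x , y)
unpair-pair x y = go _ x y refl
  where
  go : ∀ n x y → pair x y ≡ n → unpair n ≡ (x , y)
  go zero    zero    zero    e = refl
  go zero    zero    (suc y) e with () ← trans (sym (pair-suc-right 0 y)) e
  go zero    (suc x) zero    e with () ← trans (sym (pair-next-diagonal x)) e
  go zero    (suc x) (suc y) e with () ← trans (sym (pair-suc-right (suc x) y)) e
  go (suc n) zero    zero    ()
  go (suc n) x       (suc y) e
    rewrite go n (suc x) y (suc-injective (trans (sym (pair-suc-right x y)) e)) = refl
  go (suc n) (suc x) zero    e
    rewrite go n zero x (suc-injective (trans (sym (pair-next-diagonal x)) e)) = refl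

-- Opaque copies of pairing and projections: all reasoning about them goes
-- through the lemmas below, which keeps normal forms small.
opaque
  fst : ℕ → ℕ
  fst n = proj₁ (unpair n)

  snd : ℕ → ℕ
  snd n = proj₂ (unpair n)

  pr : ℕ → ℕ → ℕ
  pr = pair

opaque
  unfolding fst snd pr

  fst-def : ∀ n → fst n ≡ proj₁ (unpair n)
  fst-def n = refl

  snd-def : ∀ n → snd n ≡ proj₂ (unpair n)
  snd-def n = refl

  pr-def : ∀ x y → pr x y ≡ pair x y
  pr-def x y = refl

  fst-pr : ∀ x y → fst (pr x y) ≡ x
  fst-pr x y = cong proj₁ (unpair-pair x y)

  snd-pr : ∀ x y → snd (pr x y) ≡ y
  snd-pr x y = cong proj₂ (unpair-pair x y)

  unpair-≤ : ∀ n → fst n ≤ n × snd n ≤ n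
  unpair-≤ n = go n
    where
    go : ∀ n → proj₁ (unpair n) ≤ n × proj₂ (unpair n) ≤ n
    go zero = z≤n , z≤n
    go (suc n) with unpair n | go n
    ... | zero  , y | _ , y≤n = s≤s y≤n , z≤n
    ... | suc x , y | x≤n , y≤n = ≤-trans (n≤1+n x) (≤-trans x≤n (n≤1+n n)) , s≤s y≤n

fst-pair : ∀ x y → fst (pair x y) ≡ x
fst-pair x y = trans (cong fst (sym (pr-def x y))) (fst-pr x y)

snd-pair : ∀ x y → snd (pair x y) ≡ y
snd-pair x y = trans (cong snd (sym (pr-def x y))) (snd-pr x y)

fst-snd-pr : ∀ a b c → fst (snd (pr a (pr b c))) ≡ b
fst-snd-pr a b c = trans (cong fst (snd-pr a _)) (fst-pr b c)

snd-snd-pr : ∀ a b c → snd (snd (pr a (pr b c))) ≡ c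
snd-snd-pr a b c = trans (cong snd (snd-pr a _)) (snd-pr b c)

-- Codes: decoding and encoding

node′ : (ℕ → Code) → ℕ → ℕ → Code
node′ d 0 p = zer
node′ d 1 p = succ
node′ d 2 p = idc
node′ d 3 p = fstc
node′ d 4 p = sndc
node′ d 5 p = pairc (d (fst p)) (d (snd p))
node′ d 6 p = compc (d (fst p)) (d (snd p))
node′ d 7 p = precc (d (fst p)) (d (snd p))
node′ d (suc (suc (suc (suc (suc (suc (suc (suc _)))))))) p = muc (d p)

node′-cong : ∀ {d d′ : ℕ → Code} t p → (∀ q → q ≤ p → d q ≡ d′ q) → node′ d t p ≡ node′ d′ t p
node′-cong 0 p agree = refl
node′-cong 1 p agree = refl
node′-cong 2 p agree = refl
node′-cong 3 p agree = refl
node′-cong 4 p agree = refl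
node′-cong 5 p agree = cong₂ pairc (agree _ (proj₁ (unpair-≤ p))) (agree _ (proj₂ (unpair-≤ p)))
node′-cong 6 p agree = cong₂ compc (agree _ (proj₁ (unpair-≤ p))) (agree _ (proj₂ (unpair-≤ p)))
node′-cong 7 p agree = cong₂ precc (agree _ (proj₁ (unpair-≤ p))) (agree _ (proj₂ (unpair-≤ p)))
node′-cong (suc (suc (suc (suc (suc (suc (suc (suc _)))))))) p agree = cong muc (agree p ≤-refl)

opaque
  unfolding fst snd
  decode′-suc : ∀ f n → decode′ (suc f) n ≡ node′ (decode′ f) (n % 9) (n / 9)
  decode′-suc f n with n % 9
  ... | 0 = refl
  ... | 1 = refl
  ... | 2 = refl
  ... | 3 = refl
  ... | 4 = refl
  ... | 5 = refl
  ... | 6 = refl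
  ... | 7 = refl
  ... | suc (suc (suc (suc (suc (suc (suc (suc _))))))) = refl

payload< : ∀ n → suc n / 9 ≤ n
payload< n = ≤-pred (m/n<m (suc n) 9 (s≤s (s≤s z≤n)))

decode′-fuel : ∀ f f′ m → m ≤ f → m ≤ f′ → decode′ f m ≡ decode′ f′ m
decode′-fuel zero    zero     zero    _       _        = refl
decode′-fuel zero    (suc f′) zero    _       _        = refl
decode′-fuel (suc f) zero     zero    _       _        = refl
decode′-fuel (suc f) (suc f′) zero    _       _        = refl
decode′-fuel (suc f) (suc f′) (suc m) (s≤s m≤f) (s≤s m≤f′) = begin
    decode′ (suc f) (suc m)                            ≡⟨ decode′-suc f (suc m) ⟩
    node′ (decode′ f) (suc m % 9) (suc m / 9)          ≡⟨ node′-cong (suc m % 9) _ agree ⟩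
    node′ (decode′ f′) (suc m % 9) (suc m / 9)         ≡⟨ decode′-suc f′ (suc m) ⟨
    decode′ (suc f′) (suc m)                           ∎
  where
  open ≡-Reasoning
  agree : ∀ q → q ≤ suc m / 9 → decode′ f q ≡ decode′ f′ q
  agree q q≤p = decode′-fuel f f′ q (≤-trans q≤p (≤-trans (payload< m) m≤f))
                                    (≤-trans q≤p (≤-trans (payload< m) m≤f′))

node : ℕ → ℕ → Code
node = node′ decode

decode-node : ∀ c → decode c ≡ node (c % 9) (c / 9)
decode-node zero    = refl
decode-node (suc f) = trans (decode′-suc f (suc f)) (node′-cong (suc f % 9) _ agree)
  where
  agree : ∀ q → q ≤ suc f / 9 → decode′ f q ≡ decode q
  agree q q≤p = decode′-fuel f q q (≤-trans q≤p (payload< f)) ≤-refl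

opaque
  node# : ℕ → ℕ → ℕ
  node# t p = t + p * 9

  node#-def : ∀ t p → node# t p ≡ t + p * 9
  node#-def t p = refl

decode-node# : ∀ t p → t < 9 → decode (node# t p) ≡ node t p
decode-node# t p t<9 = trans (decode-node (node# t p)) (cong₂ node tag payload)
  where
  open ≡-Reasoning
  tag : node# t p % 9 ≡ t
  tag = begin
    node# t p % 9       ≡⟨ cong (_% 9) (node#-def t p) ⟩
    (t + p * 9) % 9     ≡⟨ [m+kn]%n≡m%n t p 9 ⟩
    t % 9               ≡⟨ m<n⇒m%n≡m t<9 ⟩
    t                   ∎
  payload : node# t p / 9 ≡ p
  payload = begin
    node# t p / 9       ≡⟨ cong (_/ 9) (node#-def t p) ⟩
    (t + p * 9) / 9     ≡⟨ +-distrib-/-∣ʳ t (divides p refl) ⟩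
    t / 9 + p * 9 / 9   ≡⟨ cong₂ _+_ (m<n⇒m/n≡0 t<9) (m*n/n≡m p 9) ⟩
    p                   ∎

enc : Code → ℕ
enc zer         = 0
enc succ        = 1
enc idc         = 2
enc fstc        = 3
enc sndc        = 4
enc (pairc a b) = node# 5 (pr (enc a) (enc b))
enc (compc a b) = node# 6 (pr (enc a) (enc b))
enc (precc a b) = node# 7 (pr (enc a) (enc b))
enc (muc a)     = node# 8 (enc a)

decode-binary : ∀ {κ : Code → Code → Code} {a b} t → t < 9 →
                (∀ p → node t p ≡ κ (decode (fst p)) (decode (snd p))) →
                decode (enc a) ≡ a → decode (enc b) ≡ b →
                decode (node# t (pr (enc a) (enc b))) ≡ κ a b
decode-binary {κ} {a} {b} t t<9 node-t a-ok b-ok = begin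
    decode (node# t p)                    ≡⟨ decode-node# t p t<9 ⟩
    node t p                              ≡⟨ node-t p ⟩
    κ (decode (fst p)) (decode (snd p))   ≡⟨ cong₂ (λ u v → κ (decode u) (decode v)) (fst-pr _ _) (snd-pr _ _) ⟩
    κ (decode (enc a)) (decode (enc b))   ≡⟨ cong₂ κ a-ok b-ok ⟩
    κ a b                                 ∎
  where
  open ≡-Reasoning
  p = pr (enc a) (enc b)

decode-enc : ∀ c → decode (enc c) ≡ c
decode-enc zer  = refl
decode-enc succ = refl
decode-enc idc  = refl
decode-enc fstc = refl
decode-enc sndc = refl
decode-enc (pairc a b) = decode-binary 5 (from-yes (5 <? 9)) (λ _ → refl) (decode-enc a) (decode-enc b)
decode-enc (compc a b) = decode-binary 6 (from-yes (6 <? 9)) (λ _ → refl) (decode-enc a) (decode-enc b)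
decode-enc (precc a b) = decode-binary 7 (from-yes (7 <? 9)) (λ _ → refl) (decode-enc a) (decode-enc b)
decode-enc (muc a) = trans (decode-node# 8 (enc a) (from-yes (8 <? 9))) (cong muc (decode-enc a))

-- Evaluation: monotone in fuel, hence deterministic

>>=-just⁻¹ : ∀ {m : Maybe ℕ} {h : ℕ → Maybe ℕ} {v} → (m >>= h) ≡ just v →
             ∃ λ a → m ≡ just a × h a ≡ just v
>>=-just⁻¹ {just a} e = a , refl , e

>>=-just : ∀ {m : Maybe ℕ} {h : ℕ → Maybe ℕ} {a v} → m ≡ just a → h a ≡ just v → (m >>= h) ≡ just v
>>=-just refl e = e

mutual
  eval-suc : ∀ k c x {v} → eval k c x ≡ just v → eval (suc k) c x ≡ just v
  eval-suc zero    c           x ()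
  eval-suc (suc k) zer         x e = e
  eval-suc (suc k) succ        x e = e
  eval-suc (suc k) idc         x e = e
  eval-suc (suc k) fstc        x e = e
  eval-suc (suc k) sndc        x e = e
  eval-suc (suc k) (pairc f g) x e with >>=-just⁻¹ {eval k f x} e
  ... | a , ea , e′ with >>=-just⁻¹ {eval k g x} e′
  ... | b , eb , e″ = >>=-just (eval-suc k f x ea) (>>=-just (eval-suc k g x eb) e″)
  eval-suc (suc k) (compc f g) x e with >>=-just⁻¹ {eval k g x} e
  ... | a , ea , e′ = >>=-just (eval-suc k g x ea) (eval-suc k f a e′)
  eval-suc (suc k) (precc f g) x e = primrec-suc k f g (proj₁ (unpair x)) (proj₂ (unpair x)) e
  eval-suc (suc k) (muc f)     x e = search-suc k k f x 0 e

  primrec-suc : ∀ k f g x n {v} → primrec k f g x n ≡ just v → primrec (suc k) f g x n ≡ just v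
  primrec-suc k f g x zero    e = eval-suc k f x e
  primrec-suc k f g x (suc n) e with >>=-just⁻¹ {primrec k f g x n} e
  ... | h , eh , e′ = >>=-just (primrec-suc k f g x n eh) (eval-suc k g _ e′)

  search-suc : ∀ k b f x y {v} → search k b f x y ≡ just v → search (suc k) (suc b) f x y ≡ just v
  search-suc k zero    f x y ()
  search-suc k (suc b) f x y e with eval k f (pair x y) in eq
  ... | just zero    rewrite eval-suc k f (pair x y) eq = e
  ... | just (suc r) rewrite eval-suc k f (pair x y) eq = search-suc k b f x (suc y) e

eval-mono : ∀ {k k′} c x {v} → k ≤ k′ → eval k c x ≡ just v → eval k′ c x ≡ just v
eval-mono {k} {k′} c x {v} k≤k′ e =
  subst (λ q → eval q c x ≡ just v) (m∸n+n≡m k≤k′) (go (k′ ∸ k))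
  where
  go : ∀ m → eval (m + k) c x ≡ just v
  go zero    = e
  go (suc m) = eval-suc (m + k) c x (go m)

primrec-mono : ∀ {k k′} f g x n {v} → k ≤ k′ → primrec k f g x n ≡ just v → primrec k′ f g x n ≡ just v
primrec-mono {k} {k′} f g x n {v} k≤k′ e =
  subst (λ q → primrec k′ f g (proj₁ q) (proj₂ q) ≡ just v) (unpair-pair x n)
    (eval-mono (precc f g) (pair x n) (s≤s k≤k′)
      (subst (λ q → primrec k f g (proj₁ q) (proj₂ q) ≡ just v) (sym (unpair-pair x n)) e))

eval-det : ∀ {k k′} c x {v v′} → eval k c x ≡ just v → eval k′ c x ≡ just v′ → v ≡ v′
eval-det {k} {k′} c x e e′ =
  just-injective (trans (sym (eval-mono c x (m≤m⊔n k k′) e)) (eval-mono c x (m≤n⊔m k k′) e′))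

Halts : Code → ℕ → Set
Halts c w = ∃ λ v → ∃ λ k → eval k c w ≡ just v

-- Computable total functions and their closure properties

Computes : Code → (ℕ → ℕ) → Set
Computes c f = ∀ x → ∃ λ k → eval k c x ≡ just (f x)

record Computable (f : ℕ → ℕ) : Set where
  constructor computable
  field
    code     : Code
    computes : Computes code f
open Computable public

computable⇒recursive : ∀ {f} → Computable f → Recursive f
computable⇒recursive (computable c ok) =
  enc c , λ x → subst (λ c′ → ∃ λ k → eval k c′ x ≡ just _) (sym (decode-enc c)) (ok x)

computes-value : ∀ {f} (fc : Computable f) k x {v} → eval k (code fc) x ≡ just v → v ≡ f x
computes-value fc k x e = eval-det {k} {proj₁ (computes fc x)} (code fc) x e (proj₂ (computes fc x))

computable-ext : ∀ {f g} → Computable f → (∀ x → f x ≡ g x) → Computable g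
computable-ext (computable c ok) f≗g =
  computable c (λ x → proj₁ (ok x) , trans (proj₂ (ok x)) (cong just (f≗g x)))

zeroᶜ : Computable (λ _ → 0)
zeroᶜ = computable zer (λ x → 1 , refl)

succᶜ : Computable suc
succᶜ = computable succ (λ x → 1 , refl)

idᶜ : Computable (λ x → x)
idᶜ = computable idc (λ x → 1 , refl)

fstᶜ : Computable fst
fstᶜ = computable fstc (λ x → 1 , cong just (sym (fst-def x)))

sndᶜ : Computable snd
sndᶜ = computable sndc (λ x → 1 , cong just (sym (snd-def x)))

infixr 9 _∘ᶜ_
_∘ᶜ_ : ∀ {f g} → Computable f → Computable g → Computable (λ x → f (g x))
_∘ᶜ_ {f} {g} (computable cf okf) (computable cg okg) = computable (compc cf cg) ok
  where
  ok : Computes (compc cf cg) (λ x → f (g x))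
  ok x with okg x | okf (g x)
  ... | k₁ , e₁ | k₂ , e₂ = suc (k₁ ⊔ k₂) ,
        >>=-just (eval-mono cg x (m≤m⊔n k₁ k₂) e₁) (eval-mono cf (g x) (m≤n⊔m k₁ k₂) e₂)

prᶜ : ∀ {f g} → Computable f → Computable g → Computable (λ x → pr (f x) (g x))
prᶜ {f} {g} (computable cf okf) (computable cg okg) = computable (pairc cf cg) ok
  where
  ok : Computes (pairc cf cg) (λ x → pr (f x) (g x))
  ok x with okf x | okg x
  ... | k₁ , e₁ | k₂ , e₂ = suc (k₁ ⊔ k₂) ,
        >>=-just (eval-mono cf x (m≤m⊔n k₁ k₂) e₁)
          (>>=-just (eval-mono cg x (m≤n⊔m k₁ k₂) e₂) (cong just (sym (pr-def (f x) (g x)))))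

primRec : (ℕ → ℕ) → (ℕ → ℕ) → ℕ → ℕ → ℕ
primRec f g x zero    = f x
primRec f g x (suc n) = g (pr x (pr n (primRec f g x n)))

precᶜ : ∀ {f g} → Computable f → Computable g → Computable (λ w → primRec f g (fst w) (snd w))
precᶜ {f} {g} (computable cf okf) (computable cg okg) = computable (precc cf cg) λ w →
  suc (proj₁ (ok (fst w) (snd w))) ,
  subst₂ (λ a b → primrec (proj₁ (ok (fst w) (snd w))) cf cg a b ≡ just (primRec f g (fst w) (snd w)))
    (fst-def w) (snd-def w) (proj₂ (ok (fst w) (snd w)))
  where
  ok : ∀ x n → ∃ λ k → primrec k cf cg x n ≡ just (primRec f g x n)
  ok x zero = okf x
  ok x (suc n) with ok x n | okg (pr x (pr n (primRec f g x n)))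
  ... | k₁ , e₁ | k₂ , e₂ = k₁ ⊔ k₂ ,
        >>=-just (primrec-mono cf cg x n (m≤m⊔n k₁ k₂) e₁)
          (subst (λ q → eval (k₁ ⊔ k₂) cg q ≡ just (g (pr x (pr n (primRec f g x n)))))
             (trans (pr-def x _) (cong (pair x) (pr-def n _)))
             (eval-mono cg _ (m≤n⊔m k₁ k₂) e₂))

Computable₂ : (ℕ → ℕ → ℕ) → Set
Computable₂ h = Computable (λ p → h (fst p) (snd p))

Computable₃ : (ℕ → ℕ → ℕ → ℕ) → Set
Computable₃ h = Computable (λ p → h (fst p) (fst (snd p)) (snd (snd p)))

lift₂ : ∀ h {f g} → Computable₂ h → Computable f → Computable g → Computable (λ x → h (f x) (g x))
lift₂ h {f} {g} hc fc gc = computable-ext (hc ∘ᶜ prᶜ fc gc)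
  (λ x → cong₂ h (fst-pr (f x) (g x)) (snd-pr (f x) (g x)))

lift₃ : ∀ h {f g u} → Computable₃ h → Computable f → Computable g → Computable u →
        Computable (λ x → h (f x) (g x) (u x))
lift₃ h {f} {g} {u} hc fc gc uc =
  computable-ext (lift₂ (λ a p → h a (fst p) (snd p)) hc fc (prᶜ gc uc))
    (λ x → cong₂ (h (f x)) (fst-pr (g x) (u x)) (snd-pr (g x) (u x)))

constᶜ : ∀ n → Computable (λ _ → n)
constᶜ zero    = zeroᶜ
constᶜ (suc n) = succᶜ ∘ᶜ constᶜ n

natrec : ℕ → (ℕ → ℕ → ℕ) → ℕ → ℕ
natrec a g zero    = a
natrec a g (suc n) = g n (natrec a g n)

natrecᶜ : ∀ a {g} → Computable₂ g → Computable (natrec a g)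
natrecᶜ a {g} gc =
  computable-ext (precᶜ (constᶜ a) (lift₂ g gc (fstᶜ ∘ᶜ sndᶜ) (sndᶜ ∘ᶜ sndᶜ)) ∘ᶜ prᶜ zeroᶜ idᶜ) λ n →
    subst₂ (λ x m → primRec (λ _ → a) step x m ≡ natrec a g n) (sym (fst-pr 0 n)) (sym (snd-pr 0 n)) (go n)
  where
  step : ℕ → ℕ
  step w = g (fst (snd w)) (snd (snd w))
  go : ∀ n → primRec (λ _ → a) step 0 n ≡ natrec a g n
  go zero    = refl
  go (suc n) = cong₂ g (fst-snd-pr 0 n _) (trans (snd-snd-pr 0 n _) (go n))

-- Arithmetic and case distinction are computable

+-computable : Computable₂ _+_
+-computable = computable-ext (precᶜ idᶜ (succᶜ ∘ᶜ sndᶜ ∘ᶜ sndᶜ)) λ p → go (fst p) (snd p)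
  where
  go : ∀ x n → primRec (λ x → x) (λ w → suc (snd (snd w))) x n ≡ x + n
  go x zero    = sym (+-identityʳ x)
  go x (suc n) = trans (cong suc (trans (snd-snd-pr x n _) (go x n))) (sym (+-suc x n))

infixl 6 _+ᶜ_ _∸ᶜ_
infixl 7 _*ᶜ_

_+ᶜ_ : ∀ {f g} → Computable f → Computable g → Computable (λ x → f x + g x)
_+ᶜ_ = lift₂ _+_ +-computable

predᶜ : ∀ {f} → Computable f → Computable (λ x → pred (f x))
predᶜ fc = computable-ext (natrecᶜ 0 fstᶜ) pred-natrec ∘ᶜ fc
  where
  pred-natrec : ∀ n → natrec 0 (λ m _ → m) n ≡ pred n
  pred-natrec zero    = refl
  pred-natrec (suc n) = refl

_∸ᶜ_ : ∀ {f g} → Computable f → Computable g → Computable (λ x → f x ∸ g x)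
_∸ᶜ_ = lift₂ _∸_ (computable-ext (precᶜ idᶜ (predᶜ (sndᶜ ∘ᶜ sndᶜ))) λ p → go (fst p) (snd p))
  where
  go : ∀ x n → primRec (λ x → x) (λ w → pred (snd (snd w))) x n ≡ x ∸ n
  go x zero    = refl
  go x (suc n) = trans (cong pred (trans (snd-snd-pr x n _) (go x n))) (pred[m∸n]≡m∸[1+n] x n)

_*ᶜ_ : ∀ {f g} → Computable f → Computable g → Computable (λ x → f x * g x)
_*ᶜ_ = lift₂ _*_ (computable-ext (precᶜ zeroᶜ (sndᶜ ∘ᶜ sndᶜ +ᶜ fstᶜ)) λ p → go (fst p) (snd p))
  where
  go : ∀ x n → primRec (λ _ → 0) (λ w → snd (snd w) + fst w) x n ≡ x * n
  go x zero    = sym (*-zeroʳ x)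
  go x (suc n) = trans (cong₂ _+_ (trans (snd-snd-pr x n _) (go x n)) (fst-pr x _))
                       (trans (+-comm (x * n) x) (sym (*-suc x n)))

ifz : ℕ → ℕ → ℕ → ℕ
ifz zero    a b = a
ifz (suc _) a b = b

ifzᶜ : ∀ {t f g} → Computable t → Computable f → Computable g → Computable (λ x → ifz (t x) (f x) (g x))
ifzᶜ = lift₃ ifz (computable-ext (precᶜ fstᶜ (sndᶜ ∘ᶜ fstᶜ) ∘ᶜ prᶜ sndᶜ fstᶜ) select)
  where
  go : ∀ w t → primRec fst (λ v → snd (fst v)) w t ≡ ifz t (fst w) (snd w)
  go w zero    = refl
  go w (suc t) = cong snd (fst-pr w _)
  select : ∀ p → primRec fst (λ v → snd (fst v)) (fst (pr (snd p) (fst p))) (snd (pr (snd p) (fst p)))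
                 ≡ ifz (fst p) (fst (snd p)) (snd (snd p))
  select p rewrite fst-pr (snd p) (fst p) | snd-pr (snd p) (fst p) = go (snd p) (fst p)

neq : ℕ → ℕ → ℕ
neq zero    zero    = 0
neq zero    (suc _) = 1
neq (suc _) zero    = 1
neq (suc a) (suc b) = neq a b

neq≡0 : ∀ {a b} → neq a b ≡ 0 → a ≡ b
neq≡0 {zero}  {zero}  e = refl
neq≡0 {suc a} {suc b} e = cong suc (neq≡0 e)

neq≡0-or-1 : ∀ a b → neq a b ≡ 0 ⊎ neq a b ≡ 1
neq≡0-or-1 zero    zero    = inj₁ refl
neq≡0-or-1 zero    (suc b) = inj₂ refl
neq≡0-or-1 (suc a) zero    = inj₂ refl
neq≡0-or-1 (suc a) (suc b) = neq≡0-or-1 a b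

neq≡1 : ∀ {a b} → neq a b ≡ 1 → a ≢ b
neq≡1 {zero}  {zero}  () refl
neq≡1 {suc a} {suc b} e  refl = neq≡1 {a} e refl

neqᶜ : ∀ {f} → Computable f → ∀ n → Computable (λ x → neq (f x) n)
neqᶜ fc n = lift₂ neq (computable-ext (ifzᶜ ((fstᶜ ∸ᶜ sndᶜ) +ᶜ (sndᶜ ∸ᶜ fstᶜ)) zeroᶜ (constᶜ 1))
                          λ p → go (fst p) (snd p)) fc (constᶜ n)
  where
  go : ∀ a b → ifz ((a ∸ b) + (b ∸ a)) 0 1 ≡ neq a b
  go zero    zero    = refl
  go zero    (suc b) = refl
  go (suc a) zero    = refl
  go (suc a) (suc b) = go a b

pairᶜ : ∀ {f g} → Computable f → Computable g → Computable (λ x → pair (f x) (g x))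
pairᶜ = lift₂ pair (triᶜ ∘ᶜ (fstᶜ +ᶜ sndᶜ) +ᶜ sndᶜ)
  where
  triᶜ : Computable tri
  triᶜ = computable-ext (natrecᶜ 0 (succᶜ ∘ᶜ fstᶜ +ᶜ sndᶜ)) go
    where
    go : ∀ n → natrec 0 (λ m h → suc m + h) n ≡ tri n
    go zero    = refl
    go (suc n) = cong (suc n +_) (go n)

divmod9-step : ℕ → ℕ
divmod9-step w = ifz (neq (snd w) 8) (pr (suc (fst w)) 0) (pr (fst w) (suc (snd w)))

divmod9 : ℕ → ℕ
divmod9 = natrec (pr 0 0) (λ _ w → divmod9-step w)

divmod9-correct : ∀ n → snd (divmod9 n) < 9 × snd (divmod9 n) + fst (divmod9 n) * 9 ≡ n
divmod9-correct zero rewrite fst-pr 0 0 | snd-pr 0 0 = s≤s z≤n , refl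
divmod9-correct (suc n) = step (divmod9 n) (divmod9-correct n)
  where
  step : ∀ w → snd w < 9 × snd w + fst w * 9 ≡ n →
         snd (divmod9-step w) < 9 × snd (divmod9-step w) + fst (divmod9-step w) * 9 ≡ suc n
  step w (r<9 , eq) with neq≡0-or-1 (snd w) 8
  ... | inj₁ r≡8 rewrite r≡8 | fst-pr (suc (fst w)) 0 | snd-pr (suc (fst w)) 0 =
        s≤s z≤n , cong suc (trans (cong (λ r → r + fst w * 9) (sym (neq≡0 r≡8))) eq)
  ... | inj₂ r≢8 rewrite r≢8 | fst-pr (fst w) (suc (snd w)) | snd-pr (fst w) (suc (snd w)) =
        ≤∧≢⇒< r<9 (λ e → neq≡1 r≢8 (suc-injective e)) , cong suc eq

divmod9ᶜ : Computable divmod9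
divmod9ᶜ = natrecᶜ (pr 0 0) step
  where
  step : Computable (λ p → divmod9-step (snd p))
  step = ifzᶜ (neqᶜ (sndᶜ ∘ᶜ sndᶜ) 8) (prᶜ (succᶜ ∘ᶜ fstᶜ ∘ᶜ sndᶜ) zeroᶜ)
                                      (prᶜ (fstᶜ ∘ᶜ sndᶜ) (succᶜ ∘ᶜ sndᶜ ∘ᶜ sndᶜ))

%9ᶜ : ∀ {f} → Computable f → Computable (λ x → f x % 9)
%9ᶜ fc = computable-ext (sndᶜ ∘ᶜ divmod9ᶜ) (λ n → sym (mod n)) ∘ᶜ fc
  where
  open ≡-Reasoning
  mod : ∀ n → n % 9 ≡ snd (divmod9 n)
  mod n = begin
    n % 9                                          ≡⟨ cong (_% 9) (proj₂ (divmod9-correct n)) ⟨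
    (snd (divmod9 n) + fst (divmod9 n) * 9) % 9    ≡⟨ [m+kn]%n≡m%n (snd (divmod9 n)) (fst (divmod9 n)) 9 ⟩
    snd (divmod9 n) % 9                            ≡⟨ m<n⇒m%n≡m (proj₁ (divmod9-correct n)) ⟩
    snd (divmod9 n)                                ∎

/9ᶜ : ∀ {f} → Computable f → Computable (λ x → f x / 9)
/9ᶜ fc = computable-ext (fstᶜ ∘ᶜ divmod9ᶜ) (λ n → sym (div n)) ∘ᶜ fc
  where
  open ≡-Reasoning
  div : ∀ n → n / 9 ≡ fst (divmod9 n)
  div n = begin
    n / 9                                              ≡⟨ cong (_/ 9) (proj₂ (divmod9-correct n)) ⟨
    (snd (divmod9 n) + fst (divmod9 n) * 9) / 9
      ≡⟨ +-distrib-/-∣ʳ (snd (divmod9 n)) (divides (fst (divmod9 n)) refl) ⟩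
    snd (divmod9 n) / 9 + fst (divmod9 n) * 9 / 9      ≡⟨ cong₂ _+_ (m<n⇒m/n≡0 (proj₁ (divmod9-correct n)))
                                                                    (m*n/n≡m (fst (divmod9 n)) 9) ⟩
    fst (divmod9 n)                                    ∎

-- A stack machine for eval
--
-- A configuration ⟨σ, S⟩ is a state σ and a stack S of frames.  States and
-- frames are cells: a tag with five arguments.  The machine runs eval k c x
-- by unfolding c one level at a time, pushing a frame for the work that
-- remains once a subcomputation has returned.  Returned values r are coded
-- as em: 0 for "undefined", v+1 for v.

tuple5 : ℕ → ℕ → ℕ → ℕ → ℕ → ℕ
tuple5 a b c d e = pr a (pr b (pr c (pr d e)))

#1 #2 #3 #4 #5 : ℕ → ℕ
#1 t = fst t
#2 t = fst (snd t)
#3 t = fst (snd (snd t))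
#4 t = fst (snd (snd (snd t)))
#5 t = snd (snd (snd (snd t)))

#-tuple5 : ∀ (F : ℕ → ℕ → ℕ → ℕ → ℕ → ℕ) a b c d e → let t = tuple5 a b c d e in
           F (#1 t) (#2 t) (#3 t) (#4 t) (#5 t) ≡ F a b c d e
#-tuple5 F a b c d e rewrite fst-pr a (pr b (pr c (pr d e))) | snd-pr a (pr b (pr c (pr d e)))
  | fst-pr b (pr c (pr d e)) | snd-pr b (pr c (pr d e)) | fst-pr c (pr d e) | snd-pr c (pr d e)
  | fst-pr d e | snd-pr d e = refl

cell : ℕ → ℕ → ℕ → ℕ → ℕ → ℕ → ℕ
cell t a b c d e = pr t (tuple5 a b c d e)

conf : ℕ → ℕ → ℕ
conf σ S = pr σ S

push : ℕ → ℕ → ℕ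
push F S = suc (pr F S)

em : Maybe ℕ → ℕ
em nothing  = 0
em (just v) = suc v

Eval : ℕ → ℕ → ℕ → ℕ
Eval k c x = cell 0 k c x 0 0

Prim : ℕ → ℕ → ℕ → ℕ → ℕ → ℕ
Prim k f g x n = cell 1 k f g x n

Search : ℕ → ℕ → ℕ → ℕ → ℕ → ℕ
Search k b f x y = cell 2 k b f x y

Ret : ℕ → ℕ
Ret r = cell 3 r 0 0 0 0

-- Frames, awaiting the value v of a subcomputation.
PairL : ℕ → ℕ → ℕ → ℕ       -- after the first component of pairc f g: run g
PairL k g x = cell 0 k g x 0 0

PairR : ℕ → ℕ               -- after the second component: return ⟨a,v⟩
PairR a = cell 1 a 0 0 0 0

CompF : ℕ → ℕ → ℕ           -- after g in compc f g: run f on v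
CompF k f = cell 2 k f 0 0 0

PrimF : ℕ → ℕ → ℕ → ℕ → ℕ   -- after h(x,n) = v: run g on ⟨x,⟨n,v⟩⟩
PrimF k g x n = cell 3 k g x n 0

SearchF : ℕ → ℕ → ℕ → ℕ → ℕ → ℕ   -- after f⟨x,y⟩ = v: stop if v = 0, else try y+1
SearchF k b f x y = cell 4 k b f x y

stepNode : ℕ → ℕ → ℕ → ℕ → ℕ → ℕ
stepNode k m d x S =
  ifz (neq m 0) (conf (Ret 1) S)
  (ifz (neq m 1) (conf (Ret (suc (suc x))) S)
  (ifz (neq m 2) (conf (Ret (suc x)) S)
  (ifz (neq m 3) (conf (Ret (suc (fst x))) S)
  (ifz (neq m 4) (conf (Ret (suc (snd x))) S)
  (ifz (neq m 5) (conf (Eval k (fst d) x) (push (PairL k (snd d) x) S))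
  (ifz (neq m 6) (conf (Eval k (snd d) x) (push (CompF k (fst d)) S))
  (ifz (neq m 7) (conf (Prim k (fst d) (snd d) (fst x) (snd x)) S)
  (conf (Search k k d x 0) S))))))))

stepEval : ℕ → ℕ → ℕ → ℕ → ℕ
stepEval k c x S = ifz k (conf (Ret 0) S) (stepNode (pred k) (c % 9) (c / 9) x S)

stepPrim : ℕ → ℕ → ℕ → ℕ → ℕ → ℕ → ℕ
stepPrim k f g x n S =
  ifz n (conf (Eval k f x) S) (conf (Prim k f g x (pred n)) (push (PrimF k g x (pred n)) S))

stepSearch : ℕ → ℕ → ℕ → ℕ → ℕ → ℕ → ℕ
stepSearch k b f x y S =
  ifz b (conf (Ret 0) S) (conf (Eval k f (pair x y)) (push (SearchF k (pred b) f x y) S))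

resumeWith : ℕ → ℕ → ℕ → ℕ → ℕ → ℕ → ℕ → ℕ → ℕ
resumeWith v ft a b c d e R =
  ifz (neq ft 0) (conf (Eval a b c) (push (PairR v) R))
  (ifz (neq ft 1) (conf (Ret (suc (pair a v))) R)
  (ifz (neq ft 2) (conf (Eval a b v) R)
  (ifz (neq ft 3) (conf (Eval a b (pair c (pair d v))) R)
  (ifz (neq ft 4) (ifz v (conf (Ret (suc e)) R) (conf (Search a b c d (suc e)) R))
  (conf (Ret 0) R)))))

resume : ℕ → ℕ → ℕ → ℕ → ℕ → ℕ → ℕ → ℕ → ℕ
resume r ft a b c d e R = ifz r (conf (Ret 0) R) (resumeWith (pred r) ft a b c d e R)

popInto : ℕ → ℕ → ℕ → ℕ
popInto r F R = resume r (fst F) (#1 (snd F)) (#2 (snd F)) (#3 (snd F)) (#4 (snd F)) (#5 (snd F)) R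

-- Returning with an empty stack is final: the configuration s is kept.
stepRet : ℕ → ℕ → ℕ → ℕ
stepRet r S s = ifz S s (popInto r (fst (pred S)) (snd (pred S)))

stepBy : ℕ → ℕ → ℕ → ℕ → ℕ
stepBy t P S s =
  ifz (neq t 0) (stepEval (#1 P) (#2 P) (#3 P) S)
  (ifz (neq t 1) (stepPrim (#1 P) (#2 P) (#3 P) (#4 P) (#5 P) S)
  (ifz (neq t 2) (stepSearch (#1 P) (#2 P) (#3 P) (#4 P) (#5 P) S)
  (ifz (neq t 3) (stepRet (#1 P) S s) s)))

step : ℕ → ℕ
step s = stepBy (fst (fst s)) (snd (fst s)) (snd s) s

iterate : ℕ → ℕ → ℕ
iterate zero    s = s
iterate (suc t) s = step (iterate t s)

step-cell : ∀ t a b c d e S → let s = conf (cell t a b c d e) S in step s ≡ stepBy t (tuple5 a b c d e) S s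
step-cell t a b c d e S rewrite fst-pr (cell t a b c d e) S | snd-pr (cell t a b c d e) S
  | fst-pr t (tuple5 a b c d e) | snd-pr t (tuple5 a b c d e) = refl

step-Eval : ∀ k c x S → step (conf (Eval k c x) S) ≡ stepEval k c x S
step-Eval k c x S = trans (step-cell 0 k c x 0 0 S) (#-tuple5 (λ a b c _ _ → stepEval a b c S) k c x 0 0)

step-Prim : ∀ k f g x n S → step (conf (Prim k f g x n) S) ≡ stepPrim k f g x n S
step-Prim k f g x n S = trans (step-cell 1 k f g x n S) (#-tuple5 (λ a b c d e → stepPrim a b c d e S) k f g x n)

step-Search : ∀ k b f x y S → step (conf (Search k b f x y) S) ≡ stepSearch k b f x y S
step-Search k b f x y S = trans (step-cell 2 k b f x y S) (#-tuple5 (λ a b c d e → stepSearch a b c d e S) k b f x y)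

step-Ret : ∀ r ft a b c d e R → step (conf (Ret r) (push (cell ft a b c d e) R)) ≡ resume r ft a b c d e R
step-Ret r ft a b c d e R = begin
    step (conf (Ret r) S)                                   ≡⟨ step-cell 3 r 0 0 0 0 S ⟩
    stepRet (#1 (tuple5 r 0 0 0 0)) S (conf (Ret r) S)      ≡⟨ cong (λ q → stepRet q S (conf (Ret r) S)) (fst-pr r _) ⟩
    popInto r (fst (pr F R)) (snd (pr F R))                 ≡⟨ cong₂ (popInto r) (fst-pr F R) (snd-pr F R) ⟩
    popInto r F R                                           ≡⟨ pop-cell ⟩
    resume r ft a b c d e R                                 ∎
  where
  open ≡-Reasoning
  F = cell ft a b c d e
  S = push F R
  pop-cell : popInto r F R ≡ resume r ft a b c d e R
  pop-cell rewrite fst-pr ft (tuple5 a b c d e) | snd-pr ft (tuple5 a b c d e) =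
    #-tuple5 (λ a b c d e → resume r ft a b c d e R) a b c d e

step-final : ∀ r → step (conf (Ret r) 0) ≡ conf (Ret r) 0
step-final r = step-cell 3 r 0 0 0 0 0

_↝_ : ℕ → ℕ → Set
s ↝ s′ = ∃ λ t → iterate t s ≡ s′

iterate-+ : ∀ t₂ t₁ s → iterate (t₂ + t₁) s ≡ iterate t₂ (iterate t₁ s)
iterate-+ zero     t₁ s = refl
iterate-+ (suc t₂) t₁ s = cong step (iterate-+ t₂ t₁ s)

↝-refl : ∀ {s} → s ↝ s
↝-refl = 0 , refl

↝-trans : ∀ {a b c} → a ↝ b → b ↝ c → a ↝ c
↝-trans {a} (t₁ , e₁) (t₂ , e₂) =
  t₂ + t₁ , trans (iterate-+ t₂ t₁ a) (trans (cong (iterate t₂) e₁) e₂)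

↝-step : ∀ {a b c} → step a ≡ b → b ↝ c → a ↝ c
↝-step {a} e (t , e′) = ↝-trans (1 , e) (t , e′)

↝-undefined : ∀ ft a b c d e R → conf (Ret 0) (push (cell ft a b c d e) R) ↝ conf (Ret 0) R
↝-undefined ft a b c d e R = ↝-step (step-Ret 0 ft a b c d e R) ↝-refl

mutual
  sim-eval : ∀ k c x S → conf (Eval k c x) S ↝ conf (Ret (em (eval k (decode c) x))) S
  sim-eval zero    c x S = ↝-step (step-Eval 0 c x S) ↝-refl
  sim-eval (suc k) c x S = ↝-step (step-Eval (suc k) c x S)
    (subst (λ c′ → stepNode k (c % 9) (c / 9) x S ↝ conf (Ret (em (eval (suc k) c′ x))) S)
       (sym (decode-node c)) (sim-node k (c % 9) (c / 9) x S))

  sim-node : ∀ k m d x S → stepNode k m d x S ↝ conf (Ret (em (eval (suc k) (node m d) x))) S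
  sim-node k 0 d x S = ↝-refl
  sim-node k 1 d x S = ↝-refl
  sim-node k 2 d x S = ↝-refl
  sim-node k 3 d x S rewrite fst-def x = ↝-refl
  sim-node k 4 d x S rewrite snd-def x = ↝-refl
  sim-node k 5 d x S with eval k (decode (fst d)) x | sim-eval k (fst d) x (push (PairL k (snd d) x) S)
  ... | nothing | left = ↝-trans left (↝-undefined 0 k (snd d) x 0 0 S)
  ... | just a  | left with eval k (decode (snd d)) x | sim-eval k (snd d) x (push (PairR a) S)
  ...   | nothing | right = ↝-trans left (↝-step (step-Ret (suc a) 0 k (snd d) x 0 0 S)
                              (↝-trans right (↝-undefined 1 a 0 0 0 0 S)))
  ...   | just b  | right = ↝-trans left (↝-step (step-Ret (suc a) 0 k (snd d) x 0 0 S)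
                              (↝-trans right (↝-step (step-Ret (suc b) 1 a 0 0 0 0 S) ↝-refl)))
  sim-node k 6 d x S with eval k (decode (snd d)) x | sim-eval k (snd d) x (push (CompF k (fst d)) S)
  ... | nothing | inner = ↝-trans inner (↝-undefined 2 k (fst d) 0 0 0 S)
  ... | just a  | inner = ↝-trans inner (↝-step (step-Ret (suc a) 2 k (fst d) 0 0 0 S) (sim-eval k (fst d) a S))
  sim-node k 7 d x S rewrite sym (fst-def x) | sym (snd-def x) = sim-prim k (fst d) (snd d) (fst x) (snd x) S
  sim-node k (suc (suc (suc (suc (suc (suc (suc (suc _)))))))) d x S = sim-search k k d x 0 S

  sim-prim : ∀ k f g x n S → conf (Prim k f g x n) S ↝ conf (Ret (em (primrec k (decode f) (decode g) x n))) S
  sim-prim k f g x zero    S = ↝-step (step-Prim k f g x 0 S) (sim-eval k f x S)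
  sim-prim k f g x (suc n) S with primrec k (decode f) (decode g) x n | sim-prim k f g x n (push (PrimF k g x n) S)
  ... | nothing | previous = ↝-step (step-Prim k f g x (suc n) S) (↝-trans previous (↝-undefined 3 k g x n 0 S))
  ... | just h  | previous = ↝-step (step-Prim k f g x (suc n) S)
        (↝-trans previous (↝-step (step-Ret (suc h) 3 k g x n 0 S) (sim-eval k g _ S)))

  sim-search : ∀ k b f x y S → conf (Search k b f x y) S ↝ conf (Ret (em (search k b (decode f) x y))) S
  sim-search k zero    f x y S = ↝-step (step-Search k 0 f x y S) ↝-refl
  sim-search k (suc b) f x y S with eval k (decode f) (pair x y) | sim-eval k f (pair x y) (push (SearchF k b f x y) S)
  ... | nothing      | test = ↝-step (step-Search k (suc b) f x y S) (↝-trans test (↝-undefined 4 k b f x y S))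
  ... | just zero    | test = ↝-step (step-Search k (suc b) f x y S)
        (↝-trans test (↝-step (step-Ret 1 4 k b f x y S) ↝-refl))
  ... | just (suc v) | test = ↝-step (step-Search k (suc b) f x y S)
        (↝-trans test (↝-step (step-Ret (suc (suc v)) 4 k b f x y S) (sim-search k b f x (suc y) S)))

-- Below,
-- a, b, …, S stand for the (computable) functions the pieces are applied to.
private variable
  a b c d e k m n r t x y F P R S : ℕ → ℕ

tuple5ᶜ : Computable a → Computable b → Computable c → Computable d → Computable e →
          Computable (λ w → tuple5 (a w) (b w) (c w) (d w) (e w))
tuple5ᶜ ac bc cc dc ec = prᶜ ac (prᶜ bc (prᶜ cc (prᶜ dc ec)))

#1ᶜ : Computable t → Computable (λ w → #1 (t w))
#1ᶜ tc = fstᶜ ∘ᶜ tc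

#2ᶜ : Computable t → Computable (λ w → #2 (t w))
#2ᶜ tc = fstᶜ ∘ᶜ sndᶜ ∘ᶜ tc

#3ᶜ : Computable t → Computable (λ w → #3 (t w))
#3ᶜ tc = fstᶜ ∘ᶜ sndᶜ ∘ᶜ sndᶜ ∘ᶜ tc

#4ᶜ : Computable t → Computable (λ w → #4 (t w))
#4ᶜ tc = fstᶜ ∘ᶜ sndᶜ ∘ᶜ sndᶜ ∘ᶜ sndᶜ ∘ᶜ tc

#5ᶜ : Computable t → Computable (λ w → #5 (t w))
#5ᶜ tc = sndᶜ ∘ᶜ sndᶜ ∘ᶜ sndᶜ ∘ᶜ sndᶜ ∘ᶜ tc

-- States and frames alike are cells; e.g. cellᶜ 0 builds PairL frames, cellᶜ 2 CompF frames.
cellᶜ : ∀ tag → Computable a → Computable b → Computable c → Computable d → Computable e →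
        Computable (λ w → cell tag (a w) (b w) (c w) (d w) (e w))
cellᶜ tag ac bc cc dc ec = prᶜ (constᶜ tag) (tuple5ᶜ ac bc cc dc ec)

pushᶜ : Computable F → Computable S → Computable (λ w → push (F w) (S w))
pushᶜ Fc Sc = succᶜ ∘ᶜ prᶜ Fc Sc

Retᶜ : Computable r → Computable (λ w → Ret (r w))
Retᶜ rc = cellᶜ 3 rc zeroᶜ zeroᶜ zeroᶜ zeroᶜ

Evalᶜ : Computable k → Computable c → Computable x → Computable (λ w → Eval (k w) (c w) (x w))
Evalᶜ kc cc xc = cellᶜ 0 kc cc xc zeroᶜ zeroᶜ

stepNodeᶜ : Computable k → Computable m → Computable d → Computable x → Computable S →
            Computable (λ w → stepNode (k w) (m w) (d w) (x w) (S w))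
stepNodeᶜ kc mc dc xc Sc =
  ifzᶜ (neqᶜ mc 0) (prᶜ (Retᶜ (constᶜ 1)) Sc)
  (ifzᶜ (neqᶜ mc 1) (prᶜ (Retᶜ (succᶜ ∘ᶜ succᶜ ∘ᶜ xc)) Sc)
  (ifzᶜ (neqᶜ mc 2) (prᶜ (Retᶜ (succᶜ ∘ᶜ xc)) Sc)
  (ifzᶜ (neqᶜ mc 3) (prᶜ (Retᶜ (succᶜ ∘ᶜ fstᶜ ∘ᶜ xc)) Sc)
  (ifzᶜ (neqᶜ mc 4) (prᶜ (Retᶜ (succᶜ ∘ᶜ sndᶜ ∘ᶜ xc)) Sc)
  (ifzᶜ (neqᶜ mc 5) (prᶜ (Evalᶜ kc (fstᶜ ∘ᶜ dc) xc) (pushᶜ (cellᶜ 0 kc (sndᶜ ∘ᶜ dc) xc zeroᶜ zeroᶜ) Sc))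
  (ifzᶜ (neqᶜ mc 6) (prᶜ (Evalᶜ kc (sndᶜ ∘ᶜ dc) xc) (pushᶜ (cellᶜ 2 kc (fstᶜ ∘ᶜ dc) zeroᶜ zeroᶜ zeroᶜ) Sc))
  (ifzᶜ (neqᶜ mc 7) (prᶜ (cellᶜ 1 kc (fstᶜ ∘ᶜ dc) (sndᶜ ∘ᶜ dc) (fstᶜ ∘ᶜ xc) (sndᶜ ∘ᶜ xc)) Sc)
  (prᶜ (cellᶜ 2 kc kc dc xc zeroᶜ) Sc))))))))

stepEvalᶜ : Computable k → Computable c → Computable x → Computable S →
            Computable (λ w → stepEval (k w) (c w) (x w) (S w))
stepEvalᶜ kc cc xc Sc = ifzᶜ kc (prᶜ (Retᶜ zeroᶜ) Sc) (stepNodeᶜ (predᶜ kc) (%9ᶜ cc) (/9ᶜ cc) xc Sc)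

stepPrimᶜ : Computable k → Computable a → Computable b → Computable x → Computable n → Computable S →
            Computable (λ w → stepPrim (k w) (a w) (b w) (x w) (n w) (S w))
stepPrimᶜ kc fc gc xc nc Sc =
  ifzᶜ nc (prᶜ (Evalᶜ kc fc xc) Sc)
    (prᶜ (cellᶜ 1 kc fc gc xc (predᶜ nc)) (pushᶜ (cellᶜ 3 kc gc xc (predᶜ nc) zeroᶜ) Sc))

stepSearchᶜ : Computable k → Computable b → Computable a → Computable x → Computable y → Computable S →
              Computable (λ w → stepSearch (k w) (b w) (a w) (x w) (y w) (S w))
stepSearchᶜ kc bc fc xc yc Sc =
  ifzᶜ bc (prᶜ (Retᶜ zeroᶜ) Sc)
    (prᶜ (Evalᶜ kc fc (pairᶜ xc yc)) (pushᶜ (cellᶜ 4 kc (predᶜ bc) fc xc yc) Sc))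

resumeᶜ : Computable r → Computable t → Computable a → Computable b → Computable c →
          Computable d → Computable e → Computable R →
          Computable (λ w → resume (r w) (t w) (a w) (b w) (c w) (d w) (e w) (R w))
resumeᶜ {r = r} rc tc ac bc cc dc ec Rc = ifzᶜ rc (prᶜ (Retᶜ zeroᶜ) Rc)
  (ifzᶜ (neqᶜ tc 0) (prᶜ (Evalᶜ ac bc cc) (pushᶜ (cellᶜ 1 vc zeroᶜ zeroᶜ zeroᶜ zeroᶜ) Rc))
  (ifzᶜ (neqᶜ tc 1) (prᶜ (Retᶜ (succᶜ ∘ᶜ pairᶜ ac vc)) Rc)
  (ifzᶜ (neqᶜ tc 2) (prᶜ (Evalᶜ ac bc vc) Rc)
  (ifzᶜ (neqᶜ tc 3) (prᶜ (Evalᶜ ac bc (pairᶜ cc (pairᶜ dc vc))) Rc)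
  (ifzᶜ (neqᶜ tc 4) (ifzᶜ vc (prᶜ (Retᶜ (succᶜ ∘ᶜ ec)) Rc) (prᶜ (cellᶜ 2 ac bc cc dc (succᶜ ∘ᶜ ec)) Rc))
  (prᶜ (Retᶜ zeroᶜ) Rc))))))
  where
  vc : Computable (λ w → pred (r w))
  vc = predᶜ rc

stepByᶜ : Computable t → Computable P → Computable S → Computable x →
          Computable (λ w → stepBy (t w) (P w) (S w) (x w))
stepByᶜ {S = S} tc Pc Sc xc =
  ifzᶜ (neqᶜ tc 0) (stepEvalᶜ (#1ᶜ Pc) (#2ᶜ Pc) (#3ᶜ Pc) Sc)
  (ifzᶜ (neqᶜ tc 1) (stepPrimᶜ (#1ᶜ Pc) (#2ᶜ Pc) (#3ᶜ Pc) (#4ᶜ Pc) (#5ᶜ Pc) Sc)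
  (ifzᶜ (neqᶜ tc 2) (stepSearchᶜ (#1ᶜ Pc) (#2ᶜ Pc) (#3ᶜ Pc) (#4ᶜ Pc) (#5ᶜ Pc) Sc)
  (ifzᶜ (neqᶜ tc 3) (ifzᶜ Sc xc (resumeᶜ (#1ᶜ Pc) (fstᶜ ∘ᶜ frame) (#1ᶜ args) (#2ᶜ args)
                                          (#3ᶜ args) (#4ᶜ args) (#5ᶜ args) (sndᶜ ∘ᶜ predᶜ Sc)))
  xc)))
  where
  frame : Computable (λ w → fst (pred (S w)))
  frame = fstᶜ ∘ᶜ predᶜ Sc
  args : Computable (λ w → snd (fst (pred (S w))))
  args = sndᶜ ∘ᶜ frame

stepᶜ : Computable step
stepᶜ = stepByᶜ (fstᶜ ∘ᶜ fstᶜ) (sndᶜ ∘ᶜ fstᶜ) sndᶜ idᶜ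

iterateᶜ : Computable t → Computable x → Computable (λ w → iterate (t w) (x w))
iterateᶜ tc xc = lift₂ (λ s t → iterate t s)
  (computable-ext (precᶜ idᶜ (stepᶜ ∘ᶜ sndᶜ ∘ᶜ sndᶜ)) λ w → go (fst w) (snd w)) xc tc
  where
  go : ∀ s t → primRec (λ x → x) (λ w → step (snd (snd w))) s t ≡ iterate t s
  go s zero    = refl
  go s (suc t) = cong step (trans (snd-snd-pr s t _) (go s t))

-- Kleene normal form:  W e w  ⇔  ∃s. T(e,w,s) = 0  with T computable

-- halted s = 0 iff s is final (empty stack, returning) with a defined value.
halted : ℕ → ℕ
halted s = ifz (snd s) (ifz (neq (fst (fst s)) 3) (ifz (#1 (snd (fst s))) 1 0) 1) 1

haltedᶜ : Computable halted
haltedᶜ = ifzᶜ sndᶜ (ifzᶜ (neqᶜ (fstᶜ ∘ᶜ fstᶜ) 3) (ifzᶜ (#1ᶜ (sndᶜ ∘ᶜ fstᶜ)) (constᶜ 1) zeroᶜ)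
                                                 (constᶜ 1))
                    (constᶜ 1)

returned : ∀ r S → #1 (snd (fst (conf (Ret r) S))) ≡ r
returned r S rewrite fst-pr (Ret r) S | snd-pr 3 (tuple5 r 0 0 0 0) = fst-pr r _

halted-Ret : ∀ v → halted (conf (Ret (suc v)) 0) ≡ 0
halted-Ret v rewrite snd-pr (Ret (suc v)) 0 | fst-pr (Ret (suc v)) 0 | fst-pr 3 (tuple5 (suc v) 0 0 0 0)
  | snd-pr 3 (tuple5 (suc v) 0 0 0 0) | fst-pr (suc v) (pr 0 (pr 0 (pr 0 0))) = refl

halted⇒ : ∀ s → halted s ≡ 0 → snd s ≡ 0 × fst (fst s) ≡ 3 × #1 (snd (fst s)) ≢ 0
halted⇒ s = test (snd s) (fst (fst s)) (#1 (snd (fst s)))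
  where
  test : ∀ S t r → ifz S (ifz (neq t 3) (ifz r 1 0) 1) 1 ≡ 0 → S ≡ 0 × t ≡ 3 × r ≢ 0
  test zero t r h with neq t 3 in t≟3
  test zero t (suc r) h | zero = refl , neq≡0 t≟3 , λ ()
  test zero t zero () | zero
  test zero t r () | suc _
  test (suc _) t r ()

final-fixed : ∀ s → snd s ≡ 0 → fst (fst s) ≡ 3 → step s ≡ s
final-fixed s empty ret rewrite empty | ret = refl

fixed-later : ∀ {a s s′ t t′} → t ≤ t′ → iterate t a ≡ s → step s ≡ s → iterate t′ a ≡ s′ → s ≡ s′
fixed-later {a} {s} {s′} {t} {t′} t≤t′ e fixed e′ = begin
    s                                ≡⟨ iterate-fixed (t′ ∸ t) ⟨
    iterate (t′ ∸ t) s               ≡⟨ cong (iterate (t′ ∸ t)) e ⟨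
    iterate (t′ ∸ t) (iterate t a)   ≡⟨ iterate-+ (t′ ∸ t) t a ⟨
    iterate (t′ ∸ t + t) a           ≡⟨ cong (λ n → iterate n a) (m∸n+n≡m t≤t′) ⟩
    iterate t′ a                     ≡⟨ e′ ⟩
    s′                               ∎
  where
  open ≡-Reasoning
  iterate-fixed : ∀ m → iterate m s ≡ s
  iterate-fixed zero    = refl
  iterate-fixed (suc m) = trans (cong step (iterate-fixed m)) fixed

fixed-unique : ∀ {a s s′} → a ↝ s → step s ≡ s → a ↝ s′ → step s′ ≡ s′ → s ≡ s′
fixed-unique (t , e) fixed (t′ , e′) fixed′ with ≤-total t t′
... | inj₁ t≤t′ = fixed-later t≤t′ e fixed e′
... | inj₂ t′≤t = sym (fixed-later t′≤t e′ fixed′ e)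

-- run e w ⟨k,t⟩: the configuration after t steps of running eval k e w.
run : ℕ → ℕ → ℕ → ℕ
run e w s = iterate (snd s) (conf (Eval (fst s) e w) 0)

T : ℕ → ℕ → ℕ → ℕ
T e w s = halted (run e w s)

Tᶜ : ∀ {e w s} → Computable e → Computable w → Computable s → Computable (λ x → T (e x) (w x) (s x))
Tᶜ ec wc sc = haltedᶜ ∘ᶜ iterateᶜ (sndᶜ ∘ᶜ sc) (prᶜ (Evalᶜ (fstᶜ ∘ᶜ sc) ec wc) zeroᶜ)

normal-form : ∀ e w → W e w ⇔ (∃ λ s → T e w s ≡ 0)
normal-form e w = mk⇔ converges⇒T T⇒converges
  where
  converges⇒T : W e w → ∃ λ s → T e w s ≡ 0
  converges⇒T (v , k , converges) with sim-eval k e w 0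
  ... | t , reaches = pr k t , goal
    where
    goal : halted (iterate (snd (pr k t)) (conf (Eval (fst (pr k t)) e w) 0)) ≡ 0
    goal rewrite fst-pr k t | snd-pr k t | reaches | converges = halted-Ret v

  T⇒converges : (∃ λ s → T e w s ≡ 0) → W e w
  T⇒converges (s , T≡0) with halted⇒ (run e w s) T≡0
  ... | empty , ret , defined = from-final (eval (fst s) (decode e) w) refl final≡
    where
    final≡ : run e w s ≡ conf (Ret (em (eval (fst s) (decode e) w))) 0
    final≡ = fixed-unique (snd s , refl) (final-fixed _ empty ret) (sim-eval (fst s) e w 0) (step-final _)
    from-final : ∀ m → eval (fst s) (decode e) w ≡ m → run e w s ≡ conf (Ret (em m)) 0 → W e w
    from-final nothing  _ final = ⊥-elim (defined (trans (cong (λ c → #1 (snd (fst c))) final) (returned 0 0)))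
    from-final (just v) converges _ = v , fst s , converges

-- μ-search: Σ⁰₁ relations with computable matrix are uniformly r.e.

halts-∘ : ∀ {g} (gc : Computable g) Q w → Halts (compc Q (code gc)) w ⇔ Halts Q (g w)
halts-∘ {g} gc Q w = mk⇔ inner outer
  where
  inner : Halts (compc Q (code gc)) w → Halts Q (g w)
  inner (v , zero , ())
  inner (v , suc k , e) with >>=-just⁻¹ {eval k (code gc) w} e
  ... | a , ea , eb = v , k , subst (λ q → eval k Q q ≡ just v) (computes-value gc k w ea) eb
  outer : Halts Q (g w) → Halts (compc Q (code gc)) w
  outer (v , kq , eq) with computes gc w
  ... | kg , eg = v , suc (kg ⊔ kq) ,
        >>=-just (eval-mono (code gc) w (m≤m⊔n kg kq) eg) (eval-mono Q (g w) (m≤n⊔m kg kq) eq)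

module μ-search {h : ℕ → ℕ} (hc : Computable h) where

  search-sound : ∀ k b u y₀ {v} → search k b (code hc) u y₀ ≡ just v → h (pair u v) ≡ 0
  search-sound k zero    u y₀ ()
  search-sound k (suc b) u y₀ e with eval k (code hc) (pair u y₀) in eq
  search-sound k (suc b) u y₀ refl | just zero    = sym (computes-value hc k (pair u y₀) eq)
  search-sound k (suc b) u y₀ e    | just (suc r) = search-sound k b u (suc y₀) e

  search-complete : ∀ m u y₀ → h (pair u (m + y₀)) ≡ 0 →
                    ∃ λ K → ∀ k b → K ≤ k → m < b → ∃ λ v → search k b (code hc) u y₀ ≡ just v
  search-complete m u y₀ zero-at with h (pair u y₀) in hy | computes hc (pair u y₀)
  ... | zero | kh , eh = kh , λ { k (suc b) kh≤k _ → y₀ , found k b kh≤k }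
    where
    found : ∀ k b → kh ≤ k → search k (suc b) (code hc) u y₀ ≡ just y₀
    found k b kh≤k rewrite eval-mono (code hc) (pair u y₀) kh≤k eh = refl
  search-complete zero u y₀ zero-at | suc r | _ with () ← trans (sym hy) zero-at
  search-complete (suc m) u y₀ zero-at | suc r | kh , eh
    with search-complete m u (suc y₀) (trans (cong (λ q → h (pair u q)) (+-suc m y₀)) zero-at)
  ... | K , later = kh ⊔ K , λ { k (suc b) K≤k (s≤s m<b) → continue k b K≤k m<b }
    where
    continue : ∀ k b → kh ⊔ K ≤ k → m < b → ∃ λ v → search k (suc b) (code hc) u y₀ ≡ just v
    continue k b K≤k m<b rewrite eval-mono (code hc) (pair u y₀) (≤-trans (m≤m⊔n kh K) K≤k) eh =
      later k b (≤-trans (m≤n⊔m kh K) K≤k) m<b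

  halts-μ : ∀ u → Halts (muc (code hc)) u ⇔ (∃ λ y → h (pair u y) ≡ 0)
  halts-μ u = mk⇔ sound complete
    where
    sound : Halts (muc (code hc)) u → ∃ λ y → h (pair u y) ≡ 0
    sound (v , zero , ())
    sound (v , suc k , e) = v , search-sound k k u 0 e
    complete : (∃ λ y → h (pair u y) ≡ 0) → Halts (muc (code hc)) u
    complete (y , zero-at) with search-complete y u 0 (trans (cong (λ q → h (pair u q)) (+-identityʳ y)) zero-at)
    ... | K , succeeds with succeeds (K ⊔ suc y) (K ⊔ suc y) (m≤m⊔n K (suc y)) (m≤n⊔m K (suc y))
    ... | v , e = v , suc (K ⊔ suc y) , e

node#ᶜ : Computable₂ node#
node#ᶜ = computable-ext (fstᶜ +ᶜ sndᶜ *ᶜ constᶜ 9) (λ p → sym (node#-def (fst p) (snd p)))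

enc-constᶜ : Computable (λ x → enc (code (constᶜ x)))
enc-constᶜ = computable-ext (natrecᶜ 0 (lift₂ node# node#ᶜ (constᶜ 6) (prᶜ (constᶜ 1) sndᶜ))) go
  where
  go : ∀ x → natrec 0 (λ _ e → node# 6 (pr 1 e)) x ≡ enc (code (constᶜ x))
  go zero    = refl
  go (suc x) = cong (λ e → node# 6 (pr 1 e)) (go x)

-- Uniformly Σ⁰₁ sets are uniformly r.e. (an instance of the s-m-n theorem):
-- for computable h there is a computable f with  W (f x) u ⇔ ∃y. h⟨⟨x,u⟩,y⟩ = 0
-- (the inner pair written with the opaque pr).
Σ⁰₁⇒re : ∀ {h} → Computable h → Σ (ℕ → ℕ) λ f → Computable f ×
           (∀ x u → W (f x) u ⇔ (∃ λ y → h (pair (pr x u) y) ≡ 0))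
Σ⁰₁⇒re {h} hc = index , indexᶜ , λ x u →
  μ-search.halts-μ hc (pr x u) ⇔-∘ (halts-∘ (prᶜ (constᶜ x) idᶜ) (muc (code hc)) u ⇔-∘ decodes x u)
  where
  -- index x codes  u ↦ μy. h⟨⟨x,u⟩,y⟩
  program : ℕ → Code
  program x = compc (muc (code hc)) (pairc (code (constᶜ x)) idc)
  index : ℕ → ℕ
  index x = enc (program x)
  indexᶜ : Computable index
  indexᶜ = lift₂ node# node#ᶜ (constᶜ 6)
             (prᶜ (constᶜ _) (lift₂ node# node#ᶜ (constᶜ 5) (prᶜ enc-constᶜ (constᶜ 2))))
  decodes : ∀ x u → W (index x) u ⇔ Halts (program x) u
  decodes x u = subst (λ c → W (index x) u ⇔ Halts c u) (decode-enc (program x)) (⇔-id _)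

-- Upper bound: I_XTD⁺ is Π⁰₂

-- With n = ⟨i,j,x,z,⟨s₁,⟨s₂,s₃⟩⟩⟩: if s₁, s₂, s₃ witness ⟨i,x⟩, ⟨j,x⟩,
-- ⟨i,z⟩ ∈ W_e, then y has to witness ⟨j,z⟩ ∈ W_e.
overlapTest : ℕ → ℕ → ℕ → ℕ → ℕ → ℕ → ℕ → ℕ → ℕ → ℕ
overlapTest e i j x z s₁ s₂ s₃ y =
  ifz (T e (pair i x) s₁ + T e (pair j x) s₂ + T e (pair i z) s₃) (T e (pair j z) y) 0

overlapAt : ℕ → ℕ → ℕ → ℕ
overlapAt e n y =
  overlapTest e (#1 n) (#2 n) (#3 n) (#4 n) (fst (#5 n)) (fst (snd (#5 n))) (snd (snd (#5 n))) y

overlapMatrix : ℕ → ℕ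
overlapMatrix p = overlapAt (fst p) (fst (snd p)) (snd (snd p))

overlapMatrixᶜ : Computable overlapMatrix
overlapMatrixᶜ =
  ifzᶜ (Tᶜ eᶜ (pairᶜ iᶜ xᶜ) s₁ᶜ +ᶜ Tᶜ eᶜ (pairᶜ jᶜ xᶜ) s₂ᶜ +ᶜ Tᶜ eᶜ (pairᶜ iᶜ zᶜ) s₃ᶜ)
       (Tᶜ eᶜ (pairᶜ jᶜ zᶜ) yᶜ) zeroᶜ
  where
  eᶜ : Computable fst
  eᶜ = fstᶜ
  nᶜ : Computable (λ p → fst (snd p))
  nᶜ = fstᶜ ∘ᶜ sndᶜ
  yᶜ : Computable (λ p → snd (snd p))
  yᶜ = sndᶜ ∘ᶜ sndᶜ
  iᶜ : Computable (λ p → #1 (fst (snd p)))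
  iᶜ = #1ᶜ nᶜ
  jᶜ : Computable (λ p → #2 (fst (snd p)))
  jᶜ = #2ᶜ nᶜ
  xᶜ : Computable (λ p → #3 (fst (snd p)))
  xᶜ = #3ᶜ nᶜ
  zᶜ : Computable (λ p → #4 (fst (snd p)))
  zᶜ = #4ᶜ nᶜ
  s₁ᶜ : Computable (λ p → fst (#5 (fst (snd p))))
  s₁ᶜ = fstᶜ ∘ᶜ #5ᶜ nᶜ
  s₂ᶜ : Computable (λ p → fst (snd (#5 (fst (snd p)))))
  s₂ᶜ = fstᶜ ∘ᶜ sndᶜ ∘ᶜ #5ᶜ nᶜ
  s₃ᶜ : Computable (λ p → snd (snd (#5 (fst (snd p)))))
  s₃ᶜ = sndᶜ ∘ᶜ sndᶜ ∘ᶜ #5ᶜ nᶜ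

overlapMatrix-pair : ∀ e n y → overlapMatrix (pair e (pair n y)) ≡ overlapAt e n y
overlapMatrix-pair e n y rewrite snd-pair e (pair n y) | fst-pair e (pair n y) | fst-pair n y | snd-pair n y = refl

overlapAt-tuple : ∀ e i j x z s₁ s₂ s₃ y →
  overlapAt e (tuple5 i j x z (pr s₁ (pr s₂ s₃))) y ≡ overlapTest e i j x z s₁ s₂ s₃ y
overlapAt-tuple e i j x z s₁ s₂ s₃ y =
  trans (#-tuple5 (λ i j x z s → overlapTest e i j x z (fst s) (fst (snd s)) (snd (snd s)) y) i j x z _)
        (cong₃ (λ a b c → overlapTest e i j x z a b c y)
               (fst-pr s₁ _) (fst-snd-pr s₁ s₂ s₃) (snd-snd-pr s₁ s₂ s₃))
  where
  cong₃ : ∀ (F : ℕ → ℕ → ℕ → ℕ) {a a′ b b′ c c′} → a ≡ a′ → b ≡ b′ → c ≡ c′ → F a b c ≡ F a′ b′ c′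
  cong₃ F refl refl refl = refl

overlapClosed⇔Π⁰₂ : ∀ e → OverlapClosed (Lang e) ⇔
                          (∀ n → ∃ λ y → overlapMatrix (pair e (pair n y)) ≡ 0)
overlapClosed⇔Π⁰₂ e = mk⇔ closed⇒matrix matrix⇒closed
  where
  test-satisfiable : ∀ i j x z s₁ s₂ s₃ → (Lang e i x → Lang e j x → Lang e i z → Lang e j z) →
                     ∃ λ y → overlapTest e i j x z s₁ s₂ s₃ y ≡ 0
  test-satisfiable i j x z s₁ s₂ s₃ meets
    with T e (pair i x) s₁ in t₁ | T e (pair j x) s₂ in t₂ | T e (pair i z) s₃ in t₃
  ... | zero | zero | zero = to (normal-form e (pair j z))
          (meets (from (normal-form e _) (s₁ , t₁)) (from (normal-form e _) (s₂ , t₂))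
                   (from (normal-form e _) (s₃ , t₃)))
  ... | suc _ | _     | _     = 0 , refl
  ... | zero  | suc _ | _     = 0 , refl
  ... | zero  | zero  | suc _ = 0 , refl

  closed⇒matrix : OverlapClosed (Lang e) → ∀ n → ∃ λ y → overlapMatrix (pair e (pair n y)) ≡ 0
  closed⇒matrix oc n with test-satisfiable (#1 n) (#2 n) (#3 n) (#4 n) (fst (#5 n)) (fst (snd (#5 n)))
                                           (snd (snd (#5 n))) (oc (#1 n) (#2 n) (#3 n) (#4 n))
  ... | y , test = y , trans (overlapMatrix-pair e n y) test

  matrix⇒closed : (∀ n → ∃ λ y → overlapMatrix (pair e (pair n y)) ≡ 0) → OverlapClosed (Lang e)
  matrix⇒closed Π i j x z ix jx iz
    with to (normal-form e _) ix | to (normal-form e _) jx | to (normal-form e _) iz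
  ... | s₁ , t₁ | s₂ , t₂ | s₃ , t₃ with Π (tuple5 i j x z (pr s₁ (pr s₂ s₃)))
  ... | y , test = from (normal-form e (pair j z)) (y , jz)
    where
    jz : T e (pair j z) y ≡ 0
    jz = subst (λ q → ifz q (T e (pair j z) y) 0 ≡ 0)
               (trans (cong₂ (λ a b → a + b + T e (pair i z) s₃) t₁ t₂) t₃)
           (trans (sym (overlapAt-tuple e i j x z s₁ s₂ s₃ y)) (trans (sym (overlapMatrix-pair e _ y)) test))

I-XTD⁺-Π⁰₂ : IsΠ⁰₂ I-XTD⁺
I-XTD⁺-Π⁰₂ = overlapMatrix , computable⇒recursive overlapMatrixᶜ ,
             λ e → overlapClosed⇔Π⁰₂ e ⇔-∘ XTD⁺-finite⇔overlapClosed

-- Hardness: every Π⁰₂ set many-one reduces to I_XTD⁺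

overlapClosed-switch : ∀ (𝓛 : Family) (P : ℕ → Set) → (∀ j → 𝓛 j 0) → (∀ z → 𝓛 0 z) →
                       (∀ n z → 𝓛 (suc n) (suc z) ⇔ P n) → OverlapClosed 𝓛 ⇔ (∀ n → P n)
overlapClosed-switch 𝓛 P zero∈ L₀-total switch = mk⇔ closed⇒all all⇒closed
  where
  closed⇒all : OverlapClosed 𝓛 → ∀ n → P n
  closed⇒all oc n = to (switch n 0) (oc 0 (suc n) 0 1 (zero∈ 0) (zero∈ (suc n)) (L₀-total 1))

  all⇒closed : (∀ n → P n) → OverlapClosed 𝓛
  all⇒closed all i j x z _ _ _ = total j z
    where
    total : ∀ j z → 𝓛 j z
    total j       zero    = zero∈ j
    total zero    (suc z) = L₀-total (suc z)
    total (suc n) (suc z) = from (switch n z) (all n)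

-- The reduction: ⟨j,z⟩ ∈ W_{f(x)} iff z = 0, or j = 0, or ∃y g⟨x,⟨j-1,y⟩⟩ = 0.
switchTest : (ℕ → ℕ) → ℕ → ℕ → ℕ → ℕ → ℕ
switchTest g x j z y = ifz z 0 (ifz j 0 (g (pair x (pair (pred j) y))))

switchMatrix : (ℕ → ℕ) → ℕ → ℕ
switchMatrix g q = switchTest g (fst (fst q)) (fst (snd (fst q))) (snd (snd (fst q))) (snd q)

switchMatrixᶜ : ∀ {g} → Computable g → Computable (switchMatrix g)
switchMatrixᶜ gc = ifzᶜ (sndᶜ ∘ᶜ sndᶜ ∘ᶜ fstᶜ) zeroᶜ (ifzᶜ (fstᶜ ∘ᶜ sndᶜ ∘ᶜ fstᶜ) zeroᶜ
  (gc ∘ᶜ pairᶜ (fstᶜ ∘ᶜ fstᶜ) (pairᶜ (predᶜ (fstᶜ ∘ᶜ sndᶜ ∘ᶜ fstᶜ)) sndᶜ)))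

switch-reduces : ∀ {g f : ℕ → ℕ} → (∀ x u → W (f x) u ⇔ (∃ λ y → switchMatrix g (pair (pr x u) y) ≡ 0)) →
                 ∀ x → I-XTD⁺ (f x) ⇔ (∀ n → ∃ λ y → g (pair x (pair n y)) ≡ 0)
switch-reduces {g} {f} f-spec x =
  overlapClosed-switch (Lang (f x)) _ zero∈ L₀-total switch ⇔-∘ XTD⁺-finite⇔overlapClosed
  where
  member : ∀ j z → Lang (f x) j z ⇔ (∃ λ y → switchTest g x j z y ≡ 0)
  member j z = mk⇔ (λ { (y , t) → y , trans (sym (matrix-at y)) t }) (λ { (y , t) → y , trans (matrix-at y) t })
               ⇔-∘ f-spec x (pair j z)
    where
    matrix-at : ∀ y → switchMatrix g (pair (pr x (pair j z)) y) ≡ switchTest g x j z y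
    matrix-at y rewrite fst-pair (pr x (pair j z)) y | snd-pair (pr x (pair j z)) y
      | fst-pr x (pair j z) | snd-pr x (pair j z) | fst-pair j z | snd-pair j z = refl

  zero∈ : ∀ j → Lang (f x) j 0
  zero∈ j = from (member j 0) (0 , refl)

  L₀-total : ∀ z → Lang (f x) 0 z
  L₀-total zero    = from (member 0 0) (0 , refl)
  L₀-total (suc z) = from (member 0 (suc z)) (0 , refl)

  switch : ∀ n z → Lang (f x) (suc n) (suc z) ⇔ (∃ λ y → g (pair x (pair n y)) ≡ 0)
  switch n z = member (suc n) (suc z)

Π⁰₂-hard : ∀ (A : ℕ → Set) → IsΠ⁰₂ A → A ≤ₘ I-XTD⁺
Π⁰₂-hard A (g , (c , okc) , A⇔Π) = reduction (Σ⁰₁⇒re (switchMatrixᶜ (computable (decode c) okc)))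
  where
  reduction : (Σ (ℕ → ℕ) λ f → Computable f ×
                (∀ x u → W (f x) u ⇔ (∃ λ y → switchMatrix g (pair (pr x u) y) ≡ 0))) → A ≤ₘ I-XTD⁺
  reduction (f , fᶜ , f-spec) =
    f , computable⇒recursive fᶜ , λ x → ⇔-sym (switch-reduces {g} {f} f-spec x) ⇔-∘ A⇔Π x

theorem11 : IsΠ⁰₂-complete I-XTD⁺
theorem11 = I-XTD⁺-Π⁰₂ , Π⁰₂-hard
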